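{- Let $X$ be a finite nonempty set and let $r$ be a Zadeh's fuzzy order on $X$. Let $\mathcal{A}$ be the set of all linear Zadeh's fuzzy orders $s$ on $X$ that extend $r$ (i.e. $r(x,y)\le s(x,y)$ for all $(x,y)\in X^2$). Then $r$ is the fuzzy intersection of the elements of $\mathcal{A}$, that is, $r(x,y)=\inf_{s\in\mathcal{A}} s(x,y)$ for every $(x,y)\in X^2$.
   Context: A fuzzy relation on a nonempty set $X$ is a function $r: X\times X\to[0,1]$. A Zadeh's fuzzy order on $X$ is a fuzzy relation $r$ satisfying: (i) $r(x,x)=1$ for all $x\in X$; (ii) for all $x,y\in X$, if $x\neq y$ and $r(x,y)>0$ then $r(y,x)=0$; (iii) for all $x,z\in X$, $r(x,z)\ge \sup_{y\in X}\min\{r(x,y),r(y,z)\}$. A Zadeh's fuzzy order $r$ is linear if for all $x,y\in X$, $r(x,y)>0$ or $r(y,x)>0$. The fuzzy intersection of a family of fuzzy relations is their pointwise infimum. -}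

module Defs where

open import Level using (0ℓ)
open import Data.Nat using (ℕ; suc)
open import Data.Fin using (Fin)
open import Data.Product using (_×_; ∃; Σ; _,_)
open import Data.Sum using (_⊎_)
open import Data.Empty using (⊥)
open import Relation.Nullary using (¬_; yes; no)
open import Relation.Binary.PropositionalEquality using (_≡_; _≢_)
open import Relation.Binary.Structures using (IsDecTotalOrder)
open import Algebra.Structures using (IsCommutativeRing)

-- An axiomatisation of the real numbers: a Dedekind-complete ordered field
-- (with decidable total order, as in classical mathematics).  Any two models
-- are isomorphic, so quantifying over all models is faithful to ℝ.
record Reals : Set₁ where
  infix 4 _≤_ _<_
  infixl 6 _+_
  infixl 7 _*_
  field
    Carrier : Set
    _+_ _*_ : Carrier → Carrier → Carrier
    -_      : Carrier → Carrier
    0# 1#   : Carrier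
    _≤_     : Carrier → Carrier → Set
    isCommutativeRing : IsCommutativeRing _≡_ _+_ _*_ -_ 0# 1#
    0≢1     : 0# ≢ 1#
    inverse : ∀ x → x ≢ 0# → ∃ λ y → x * y ≡ 1#
    isDecTotalOrder : IsDecTotalOrder _≡_ _≤_
    +-mono-≤ : ∀ {x y} z → x ≤ y → x + z ≤ y + z
    *-nonneg : ∀ {x y} → 0# ≤ x → 0# ≤ y → 0# ≤ x * y
    complete : (P : Carrier → Set) → (∃ λ x → P x) →
               (∃ λ b → ∀ x → P x → x ≤ b) →
               ∃ λ s → (∀ x → P x → x ≤ s) × (∀ b → (∀ x → P x → x ≤ b) → s ≤ b)

  _<_ : Carrier → Carrier → Set
  x < y = x ≤ y × x ≢ y

  _≤?_ = IsDecTotalOrder._≤?_ isDecTotalOrder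

  min : Carrier → Carrier → Carrier
  min a b with a ≤? b
  ... | yes _ = a
  ... | no  _ = b

module Fuzzy (ℝ : Reals) where
  open Reals ℝ

  -- The finite nonempty set X is represented by Fin (suc n).
  FuzzyRel : ℕ → Set
  FuzzyRel n = Fin (suc n) → Fin (suc n) → Carrier

  UnitValued : ∀ {n} → FuzzyRel n → Set
  UnitValued r = ∀ x y → (0# ≤ r x y) × (r x y ≤ 1#)

  -- Zadeh's fuzzy order. Condition (iii) "r(x,z) ≥ sup_y min(r(x,y),r(y,z))"
  -- is written out as: r(x,z) is an upper bound of all min(r(x,y),r(y,z)).
  IsZadehOrder : ∀ {n} → FuzzyRel n → Set
  IsZadehOrder r =
    UnitValued r
    × (∀ x → r x x ≡ 1#)
    × (∀ x y → x ≢ y → 0# < r x y → r y x ≡ 0#)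
    × (∀ x y z → min (r x y) (r y z) ≤ r x z)

  IsLinear : ∀ {n} → FuzzyRel n → Set
  IsLinear r = ∀ x y → (0# < r x y) ⊎ (0# < r y x)

  IsLinearZadehOrder : ∀ {n} → FuzzyRel n → Set
  IsLinearZadehOrder r = IsZadehOrder r × IsLinear r

  Extends : ∀ {n} → FuzzyRel n → FuzzyRel n → Set
  Extends r s = ∀ x y → r x y ≤ s x y

  IsInfimumAt : ∀ {n} → (FuzzyRel n → Set) → Fin (suc n) → Fin (suc n) → Carrier → Set
  IsInfimumAt A x y v =
    (∀ s → A s → v ≤ s x y)
    × (∀ b → 0# ≤ b → b ≤ 1# → (∀ s → A s → b ≤ s x y) → b ≤ v)

  IsFuzzyIntersection : ∀ {n} → (FuzzyRel n → Set) → FuzzyRel n → Set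
  IsFuzzyIntersection A r = ∀ x y → IsInfimumAt A x y (r x y)

  LinearExtensions : ∀ {n} → FuzzyRel n → FuzzyRel n → Set
  LinearExtensions r s = IsLinearZadehOrder s × Extends r s

module Submission where

-- Every linear extension lies above r,
-- so it suffices to find, for each pair x ≢ y, a linear extension s of r
-- with s(x,y) ≤ r(x,y).
--
-- Crisp half (relations on Fin k):
-- every decidable partial order ⊑ has a strict linear extension ≺ (order by
-- the size of down-sets, break ties by index), and if x ⋢ y one can first
-- add y ⊑ x, getting a linear extension with y ≺ x.  Fuzzy half: the support
-- u ⊑ v ⇔ 0 < r(u,v) of a Zadeh order r is a decidable partial order; from
-- any strict linear extension ≺ of it we build the linear Zadeh order
--   s(u,v) = r(u,v) on the support, ε on the other pairs u ≺ v, 0 elsewhere,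
-- where ε is the least positive value of r.  If r(x,y) > 0 every such s has
-- s(x,y) = r(x,y); if r(x,y) = 0, choosing ≺ with y ≺ x gives s(x,y) = 0.

open import Defs
open import Level using (0ℓ)
open import Data.Nat using (ℕ; zero; suc) renaming (_<_ to _<ℕ_)
import Data.Nat.Properties as ℕ
open import Data.Fin using (Fin; zero; suc) renaming (_≟_ to _≟ᶠ_; _<_ to _<ᶠ_)
import Data.Fin.Properties as Fin
open import Data.Fin.Subset using (Subset; _∈_; ∣_∣)
open import Data.Fin.Subset.Properties using (p⊂q⇒∣p∣<∣q∣)
open import Data.Vec using (tabulate)
open import Data.Vec.Properties using (lookup∘tabulate; []=⇒lookup; lookup⇒[]=)
open import Data.Product using (_×_; Σ; _,_; proj₁; proj₂)
open import Data.Product.Relation.Binary.Lex.Strict using (×-Lex; ×-isStrictTotalOrder)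
open import Data.Sum using (_⊎_; inj₁; inj₂)
open import Data.Empty using (⊥-elim)
open import Function using (_on_)
open import Relation.Nullary using (¬_; Dec; yes; no; does)
open import Relation.Nullary.Decidable using (dec-true; _⊎-dec_; _×-dec_)
open import Relation.Binary.Core using (Rel)
open import Relation.Binary.Definitions using (Decidable; Asymmetric; Transitive; tri<; tri≈; tri>)
open import Relation.Binary.Structures using (IsDecPartialOrder; IsStrictTotalOrder; IsDecTotalOrder)
import Relation.Binary.Construct.On as On
open import Relation.Binary.PropositionalEquality
  using (_≡_; _≢_; refl; sym; trans; cong₂; subst; isEquivalence)

record LinearExtension {k : ℕ} (R : Rel (Fin k) 0ℓ) : Set₁ where
  infix 4 _≺_ _≺?_
  field
    _≺_      : Rel (Fin k) 0ℓ
    _≺?_     : Decidable _≺_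
    ≺-asym   : Asymmetric _≺_
    ≺-trans  : Transitive _≺_
    ≺-connex : ∀ u v → u ≢ v → u ≺ v ⊎ v ≺ u
    extends  : ∀ {u v} → u ≢ v → R u v → u ≺ v

restrict : ∀ {k} {R S : Rel (Fin k) 0ℓ} → (∀ {u v} → R u v → S u v) →
           LinearExtension S → LinearExtension R
restrict R⊆S L = record
  { _≺_ = _≺_ ; _≺?_ = _≺?_ ; ≺-asym = ≺-asym ; ≺-trans = ≺-trans ; ≺-connex = ≺-connex
  ; extends = λ u≢v Ruv → extends u≢v (R⊆S Ruv)
  }
  where open LinearExtension L

module _ {k : ℕ} {_⊑_ : Rel (Fin k) 0ℓ} (po : IsDecPartialOrder _≡_ _⊑_) where
  open IsDecPartialOrder po using (_≤?_; antisym) renaming (refl to ⊑-refl; trans to ⊑-trans)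

  downSet : Fin k → Subset k
  downSet v = tabulate (λ w → does (w ≤? v))

  ∈-downSet⁺ : ∀ {w v} → w ⊑ v → w ∈ downSet v
  ∈-downSet⁺ {w} {v} w⊑v =
    lookup⇒[]= w (downSet v) (trans (lookup∘tabulate _ w) (dec-true (w ≤? v) w⊑v))

  ∈-downSet⁻ : ∀ {w v} → w ∈ downSet v → w ⊑ v
  ∈-downSet⁻ {w} {v} w∈ with w ≤? v | trans (sym (lookup∘tabulate _ w)) ([]=⇒lookup w∈)
  ... | yes w⊑v | _ = w⊑v
  ... | no _    | ()

  rank : Fin k → ℕ
  rank v = ∣ downSet v ∣

  -- The rank is strictly monotone: u ⊏ v makes downSet u a proper subset
  -- of downSet v, which contains v while downSet u does not (antisymmetry).
  rank-mono : ∀ {u v} → u ≢ v → u ⊑ v → rank u <ℕ rank v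
  rank-mono {u} {v} u≢v u⊑v = p⊂q⇒∣p∣<∣q∣
    ( (λ w∈ → ∈-downSet⁺ (⊑-trans (∈-downSet⁻ w∈) u⊑v))
    , v , ∈-downSet⁺ ⊑-refl , λ v∈ → u≢v (antisym u⊑v (∈-downSet⁻ v∈)) )

  linearExtension : LinearExtension _⊑_
  linearExtension = record
    { _≺_      = _≺_
    ; _≺?_     = IsStrictTotalOrder._<?_ sto
    ; ≺-asym   = IsStrictTotalOrder.asym sto
    ; ≺-trans  = IsStrictTotalOrder.trans sto
    ; ≺-connex = connex
    ; extends  = λ u≢v u⊑v → inj₁ (rank-mono u≢v u⊑v)
    }
    where
    key : Fin k → ℕ × Fin k
    key v = rank v , v

    _≺_ : Rel (Fin k) 0ℓ
    _≺_ = ×-Lex _≡_ _<ℕ_ _<ᶠ_ on key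

    sto = On.isStrictTotalOrder key
            (×-isStrictTotalOrder ℕ.<-isStrictTotalOrder Fin.<-isStrictTotalOrder)

    connex : ∀ u v → u ≢ v → u ≺ v ⊎ v ≺ u
    connex u v u≢v with IsStrictTotalOrder.compare sto u v
    ... | tri< u≺v _ _ = inj₁ u≺v
    ... | tri≈ _ eq _  = ⊥-elim (u≢v (proj₂ eq))
    ... | tri> _ _ v≺u = inj₂ v≺u

module _ {k : ℕ} {_⊑_ : Rel (Fin k) 0ℓ} (po : IsDecPartialOrder _≡_ _⊑_) where
  open IsDecPartialOrder po using (_≤?_; antisym) renaming (refl to ⊑-refl; trans to ⊑-trans)

  -- If x ⋢ y, the relation obtained by adding y ⊑ x (and closing under
  -- transitivity) is still a decidable partial order.
  module Reverse {x y : Fin k} (x⋢y : ¬ x ⊑ y) where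
    _⊑⁺_ : Rel (Fin k) 0ℓ
    u ⊑⁺ v = u ⊑ v ⊎ (u ⊑ y × x ⊑ v)

    ⊑⁺-trans : Transitive _⊑⁺_
    ⊑⁺-trans (inj₁ u⊑v) (inj₁ v⊑w)             = inj₁ (⊑-trans u⊑v v⊑w)
    ⊑⁺-trans (inj₁ u⊑v) (inj₂ (v⊑y , x⊑w))     = inj₂ (⊑-trans u⊑v v⊑y , x⊑w)
    ⊑⁺-trans (inj₂ (u⊑y , x⊑v)) (inj₁ v⊑w)     = inj₂ (u⊑y , ⊑-trans x⊑v v⊑w)
    ⊑⁺-trans (inj₂ (_ , x⊑v)) (inj₂ (v⊑y , _)) = ⊥-elim (x⋢y (⊑-trans x⊑v v⊑y))

    ⊑⁺-antisym : ∀ {u v} → u ⊑⁺ v → v ⊑⁺ u → u ≡ v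
    ⊑⁺-antisym (inj₁ u⊑v) (inj₁ v⊑u)             = antisym u⊑v v⊑u
    ⊑⁺-antisym (inj₁ u⊑v) (inj₂ (v⊑y , x⊑u))     = ⊥-elim (x⋢y (⊑-trans x⊑u (⊑-trans u⊑v v⊑y)))
    ⊑⁺-antisym (inj₂ (u⊑y , x⊑v)) (inj₁ v⊑u)     = ⊥-elim (x⋢y (⊑-trans x⊑v (⊑-trans v⊑u u⊑y)))
    ⊑⁺-antisym (inj₂ (_ , x⊑v)) (inj₂ (v⊑y , _)) = ⊥-elim (x⋢y (⊑-trans x⊑v v⊑y))

    isDecPartialOrder⁺ : IsDecPartialOrder _≡_ _⊑⁺_
    isDecPartialOrder⁺ = record
      { isPartialOrder = record
        { isPreorder = record
          { isEquivalence = isEquivalence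
          ; reflexive     = λ { refl → inj₁ ⊑-refl }
          ; trans         = ⊑⁺-trans
          }
        ; antisym = ⊑⁺-antisym
        }
      ; _≟_  = _≟ᶠ_
      ; _≤?_ = λ u v → (u ≤? v) ⊎-dec ((u ≤? y) ×-dec (x ≤? v))
      }

  reversingExtension : ∀ {x y} → ¬ x ⊑ y →
                       Σ (LinearExtension _⊑_) λ L → LinearExtension._≺_ L y x
  reversingExtension {x} {y} x⋢y =
    restrict inj₁ L , LinearExtension.extends L y≢x (inj₂ (⊑-refl , ⊑-refl))
    where
    open Reverse x⋢y
    L : LinearExtension _⊑⁺_
    L = linearExtension isDecPartialOrder⁺

    y≢x : y ≢ x
    y≢x refl = x⋢y ⊑-refl

module FuzzyOrders (ℝ : Reals) where
  open Reals ℝ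
  open Fuzzy ℝ
  open IsDecTotalOrder isDecTotalOrder using (_≟_)
    renaming (refl to ≤-refl; trans to ≤-trans; antisym to ≤-antisym; total to ≤-total; reflexive to ≤-reflexive)

  min-≤ˡ : ∀ a b → min a b ≤ a
  min-≤ˡ a b with a ≤? b
  ... | yes _  = ≤-refl
  ... | no a≰b with ≤-total a b
  ...   | inj₁ a≤b = ⊥-elim (a≰b a≤b)
  ...   | inj₂ b≤a = b≤a

  min-≤ʳ : ∀ a b → min a b ≤ b
  min-≤ʳ a b with a ≤? b
  ... | yes a≤b = a≤b
  ... | no _    = ≤-refl

  min-closed : (P : Carrier → Set) → ∀ {a b} → P a → P b → P (min a b)
  min-closed P {a} {b} Pa Pb with a ≤? b
  ... | yes _ = Pa
  ... | no _  = Pb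

  pos? : ∀ a → Dec (0# < a)
  pos? a with 0# ≤? a | 0# ≟ a
  ... | yes 0≤a | no 0≢a = yes (0≤a , 0≢a)
  ... | yes _   | yes 0≡a = no (λ 0<a → proj₂ 0<a 0≡a)
  ... | no 0≰a  | _       = no (λ 0<a → 0≰a (proj₁ 0<a))

  <-≤-trans : ∀ {a b} → 0# < a → a ≤ b → 0# < b
  <-≤-trans {a} (0≤a , 0≢a) a≤b =
    ≤-trans 0≤a a≤b , λ { refl → 0≢a (≤-antisym 0≤a a≤b) }

  non-positive : ∀ {a} → 0# ≤ a → ¬ (0# < a) → a ≡ 0#
  non-positive {a} 0≤a a≯0 with 0# ≟ a
  ... | yes 0≡a = sym 0≡a
  ... | no 0≢a  = ⊥-elim (a≯0 (0≤a , 0≢a))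

  minimum : ∀ {m} → (Fin (suc m) → Carrier) → Carrier
  minimum {zero}  g = g zero
  minimum {suc m} g = min (g zero) (minimum (λ i → g (suc i)))

  minimum-≤ : ∀ {m} (g : Fin (suc m) → Carrier) i → minimum g ≤ g i
  minimum-≤ {zero}  g zero    = ≤-refl
  minimum-≤ {suc m} g zero    = min-≤ˡ _ _
  minimum-≤ {suc m} g (suc i) = ≤-trans (min-≤ʳ _ _) (minimum-≤ (λ j → g (suc j)) i)

  minimum-closed : ∀ {m} (P : Carrier → Set) (g : Fin (suc m) → Carrier) →
                   (∀ i → P (g i)) → P (minimum g)
  minimum-closed {zero}  P g Pg = Pg zero
  minimum-closed {suc m} P g Pg =
    min-closed P (Pg zero) (minimum-closed P (λ i → g (suc i)) (λ i → Pg (suc i)))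

  module ZadehOrder {n : ℕ} (r : FuzzyRel n) (isZadeh : IsZadehOrder r) where
    private
      X : Set
      X = Fin (suc n)

    r-unit : UnitValued r
    r-unit = proj₁ isZadeh

    r-diag : ∀ u → r u u ≡ 1#
    r-diag = proj₁ (proj₂ isZadeh)

    r-asym : ∀ u v → u ≢ v → 0# < r u v → r v u ≡ 0#
    r-asym = proj₁ (proj₂ (proj₂ isZadeh))

    r-minTrans : ∀ u v w → min (r u v) (r v w) ≤ r u w
    r-minTrans = proj₂ (proj₂ (proj₂ isZadeh))

    -- X is nonempty and r is [0,1]-valued with r(u,u) = 1, so 0 < 1.
    0≤1 : 0# ≤ 1#
    0≤1 = subst (0# ≤_) (r-diag zero) (proj₁ (r-unit zero zero))

    0<1 : 0# < 1#
    0<1 = 0≤1 , 0≢1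

    Supp : Rel X 0ℓ
    Supp u v = 0# < r u v

    Supp-trans : Transitive Supp
    Supp-trans {u} {v} {w} p q = <-≤-trans (min-closed (0# <_) p q) (r-minTrans u v w)

    supportOrder : IsDecPartialOrder _≡_ Supp
    supportOrder = record
      { isPartialOrder = record
        { isPreorder = record
          { isEquivalence = isEquivalence
          ; reflexive     = λ { {u} refl → subst (0# <_) (sym (r-diag u)) 0<1 }
          ; trans         = Supp-trans
          }
        ; antisym = antisym
        }
      ; _≟_  = _≟ᶠ_
      ; _≤?_ = λ u v → pos? (r u v)
      }
      where
      antisym : ∀ {u v} → Supp u v → Supp v u → u ≡ v
      antisym {u} {v} p q with u ≟ᶠ v
      ... | yes u≡v = u≡v
      ... | no u≢v  = ⊥-elim (proj₂ q (sym (r-asym u v u≢v p)))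

    positivePart : X → X → Carrier
    positivePart u v with pos? (r u v)
    ... | yes _ = r u v
    ... | no _  = 1#

    InUnitInterval⁺ : Carrier → Set
    InUnitInterval⁺ a = 0# < a × a ≤ 1#

    positivePart-bounds : ∀ u v → InUnitInterval⁺ (positivePart u v)
    positivePart-bounds u v with pos? (r u v)
    ... | yes p = p , proj₂ (r-unit u v)
    ... | no _  = 0<1 , ≤-refl

    positivePart-supp : ∀ {u v} → Supp u v → positivePart u v ≡ r u v
    positivePart-supp {u} {v} p with pos? (r u v)
    ... | yes _ = refl
    ... | no ¬p = ⊥-elim (¬p p)

    -- ε is the least positive value of r.
    ε : Carrier
    ε = minimum (λ u → minimum (λ v → positivePart u v))

    ε-bounds : InUnitInterval⁺ ε
    ε-bounds = minimum-closed InUnitInterval⁺ _ λ u →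
               minimum-closed InUnitInterval⁺ _ λ v → positivePart-bounds u v

    ε-least : ∀ {u v} → Supp u v → ε ≤ r u v
    ε-least {u} {v} p = ≤-trans (minimum-≤ _ u)
      (≤-trans (minimum-≤ _ v) (≤-reflexive (positivePart-supp p)))

    0≤ε : 0# ≤ ε
    0≤ε = proj₁ (proj₁ ε-bounds)

    module Extension (L : LinearExtension Supp) where
      open LinearExtension L

      data Entry (u v : X) : Set where
        diagonal  : u ≡ v → Entry u v
        supported : u ≢ v → Supp u v → Entry u v
        added     : u ≢ v → ¬ Supp u v → u ≺ v → Entry u v
        absent    : u ≢ v → ¬ Supp u v → ¬ u ≺ v → Entry u v

      entry : ∀ u v → Entry u v
      entry u v with u ≟ᶠ v
      ... | yes u≡v = diagonal u≡v
      ... | no u≢v with pos? (r u v)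
      ...   | yes p = supported u≢v p
      ...   | no ¬p with u ≺? v
      ...     | yes u≺v = added u≢v ¬p u≺v
      ...     | no u⊀v  = absent u≢v ¬p u⊀v

      value : ∀ {u v} → Entry u v → Carrier
      value (diagonal _)             = 1#
      value {u} {v} (supported _ _) = r u v
      value (added _ _ _)            = ε
      value (absent _ _ _)           = 0#

      s : FuzzyRel n
      s u v = value (entry u v)

      s-unit : UnitValued s
      s-unit u v with entry u v
      ... | diagonal _      = 0≤1 , ≤-refl
      ... | supported _ _   = r-unit u v
      ... | added _ _ _     = 0≤ε , proj₂ ε-bounds
      ... | absent _ _ _    = ≤-refl , 0≤1

      s-diag : ∀ u → s u u ≡ 1#
      s-diag u with entry u u
      ... | diagonal _      = refl
      ... | supported u≢u _ = ⊥-elim (u≢u refl)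
      ... | added u≢u _ _   = ⊥-elim (u≢u refl)
      ... | absent u≢u _ _  = ⊥-elim (u≢u refl)

      s-pos : ∀ {u v} → u ≺ v → 0# < s u v
      s-pos {u} {v} u≺v with entry u v
      ... | diagonal _     = 0<1
      ... | supported _ p  = p
      ... | added _ _ _    = proj₁ ε-bounds
      ... | absent _ _ u⊀v = ⊥-elim (u⊀v u≺v)

      s-zero : ∀ {u v} → u ≢ v → ¬ u ≺ v → s u v ≡ 0#
      s-zero {u} {v} u≢v u⊀v with entry u v
      ... | diagonal u≡v    = ⊥-elim (u≢v u≡v)
      ... | supported _ p   = ⊥-elim (u⊀v (extends u≢v p))
      ... | added _ _ u≺v   = ⊥-elim (u⊀v u≺v)
      ... | absent _ _ _    = refl

      s-exact : ∀ {u v} → Supp u v → s u v ≡ r u v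
      s-exact {u} {v} p with entry u v
      ... | diagonal refl   = sym (r-diag u)
      ... | supported _ _   = refl
      ... | added _ ¬p _    = ⊥-elim (¬p p)
      ... | absent _ ¬p _   = ⊥-elim (¬p p)

      s-extends : Extends r s
      s-extends u v with entry u v
      ... | diagonal refl   = ≤-reflexive (r-diag u)
      ... | supported _ _   = ≤-refl
      ... | added _ ¬p _    = ≤-trans (≤-reflexive (non-positive (proj₁ (r-unit u v)) ¬p)) 0≤ε
      ... | absent _ ¬p _   = ≤-reflexive (non-positive (proj₁ (r-unit u v)) ¬p)

      s-small-or-exact : ∀ {u v} → u ≢ v → s u v ≤ ε ⊎ (Supp u v × s u v ≡ r u v)
      s-small-or-exact {u} {v} u≢v with entry u v
      ... | diagonal u≡v    = ⊥-elim (u≢v u≡v)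
      ... | supported _ p   = inj₂ (p , refl)
      ... | added _ _ _     = inj₁ ≤-refl
      ... | absent _ _ _    = inj₁ 0≤ε

      s-asym : ∀ u v → u ≢ v → 0# < s u v → s v u ≡ 0#
      s-asym u v u≢v 0<s = s-zero (λ v≡u → u≢v (sym v≡u)) (≺-asym u≺v)
        where
        u≺v : u ≺ v
        u≺v with u ≺? v
        ... | yes u≺v = u≺v
        ... | no u⊀v  = ⊥-elim (proj₂ 0<s (sym (s-zero u≢v u⊀v)))

      s-linear : IsLinear s
      s-linear u v with entry u v
      ... | diagonal _         = inj₁ 0<1
      ... | supported _ p      = inj₁ p
      ... | added _ _ _        = inj₁ (proj₁ ε-bounds)
      ... | absent u≢v _ u⊀v with ≺-connex u v u≢v
      ...   | inj₁ u≺v = ⊥-elim (u⊀v u≺v)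
      ...   | inj₂ v≺u = inj₂ (s-pos v≺u)

      s-trans-supported : ∀ {a b c} → a ≢ b → b ≢ c → Supp a c → min (s a b) (s b c) ≤ r a c
      s-trans-supported {a} {b} {c} a≢b b≢c p with s-small-or-exact a≢b | s-small-or-exact b≢c
      ... | inj₁ ab≤ε | _ = ≤-trans (min-≤ˡ _ _) (≤-trans ab≤ε (ε-least p))
      ... | _ | inj₁ bc≤ε = ≤-trans (min-≤ʳ _ _) (≤-trans bc≤ε (ε-least p))
      ... | inj₂ (_ , ab≡r) | inj₂ (_ , bc≡r) =
        ≤-trans (≤-reflexive (cong₂ min ab≡r bc≡r)) (r-minTrans a b c)

      s-trans-added : ∀ {a b c} → a ≢ b → b ≢ c → ¬ Supp a c → min (s a b) (s b c) ≤ ε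
      s-trans-added a≢b b≢c ¬p with s-small-or-exact a≢b | s-small-or-exact b≢c
      ... | inj₁ ab≤ε | _ = ≤-trans (min-≤ˡ _ _) ab≤ε
      ... | _ | inj₁ bc≤ε = ≤-trans (min-≤ʳ _ _) bc≤ε
      ... | inj₂ (p , _) | inj₂ (q , _) = ⊥-elim (¬p (Supp-trans p q))

      s-trans-absent : ∀ {a b c} → a ≢ b → b ≢ c → ¬ a ≺ c → min (s a b) (s b c) ≤ 0#
      s-trans-absent {a} {b} {c} a≢b b≢c a⊀c with a ≺? b | b ≺? c
      ... | no a⊀b | _      = ≤-trans (min-≤ˡ _ _) (≤-reflexive (s-zero a≢b a⊀b))
      ... | yes _ | no b⊀c  = ≤-trans (min-≤ʳ _ _) (≤-reflexive (s-zero b≢c b⊀c))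
      ... | yes a≺b | yes b≺c = ⊥-elim (a⊀c (≺-trans a≺b b≺c))

      s-trans-distinct : ∀ {a b c} → a ≢ b → b ≢ c → min (s a b) (s b c) ≤ s a c
      s-trans-distinct {a} {b} {c} a≢b b≢c with entry a c
      ... | diagonal refl  = ≤-trans (min-≤ˡ _ _) (proj₂ (s-unit a b))
      ... | supported _ p  = s-trans-supported a≢b b≢c p
      ... | added _ ¬p _   = s-trans-added a≢b b≢c ¬p
      ... | absent _ _ a⊀c = s-trans-absent a≢b b≢c a⊀c

      s-trans-cases : ∀ {a b c} → Dec (a ≡ b) → Dec (b ≡ c) → min (s a b) (s b c) ≤ s a c
      s-trans-cases (yes refl) _      = min-≤ʳ _ _
      s-trans-cases (no _) (yes refl) = min-≤ˡ _ _
      s-trans-cases (no a≢b) (no b≢c) = s-trans-distinct a≢b b≢c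

      s-trans : ∀ a b c → min (s a b) (s b c) ≤ s a c
      s-trans a b c = s-trans-cases (a ≟ᶠ b) (b ≟ᶠ c)

      s-linearExtension : LinearExtensions r s
      s-linearExtension = ((s-unit , s-diag , s-asym , s-trans) , s-linear) , s-extends

    -- For x ≢ y some linear extension s of r has s(x,y) ≤ r(x,y): if
    -- r(x,y) > 0 any s built above agrees with r at (x,y); otherwise build s
    -- from a linear extension of the support with y ≺ x, so that s(x,y) = 0.
    sharpExtension : ∀ {x y} → x ≢ y → Σ (FuzzyRel n) λ s → LinearExtensions r s × s x y ≤ r x y
    sharpExtension {x} {y} x≢y with pos? (r x y)
    ... | yes p = s , s-linearExtension , ≤-reflexive (s-exact p)
      where open Extension (linearExtension supportOrder)
    ... | no ¬p with reversingExtension supportOrder ¬p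
    ...   | L , y≺x = s , s-linearExtension ,
                      ≤-trans (≤-reflexive (s-zero x≢y (≺-asym y≺x))) (proj₁ (r-unit x y))
      where
      open LinearExtension L using (≺-asym)
      open Extension L

    isIntersection : IsFuzzyIntersection (LinearExtensions r) r
    isIntersection x y = (λ s s∈A → proj₂ s∈A x y) , greatest
      where
      greatest : ∀ b → 0# ≤ b → b ≤ 1# → (∀ s → LinearExtensions r s → b ≤ s x y) → b ≤ r x y
      greatest b _ b≤1 below with x ≟ᶠ y
      ... | yes refl = ≤-trans b≤1 (≤-reflexive (sym (r-diag x)))
      ... | no x≢y with sharpExtension x≢y
      ...   | s , s∈A , sxy≤rxy = ≤-trans (below s s∈A) sxy≤rxy

theorem3p1 : (ℝ : Reals) → let open Fuzzy ℝ in
    (n : ℕ) (r : FuzzyRel n) → IsZadehOrder r →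
    IsFuzzyIntersection (LinearExtensions r) r
theorem3p1 ℝ n r isZadeh = FuzzyOrders.ZadehOrder.isIntersection ℝ r isZadeh
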